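{- Let $w\ge0$ be an integer and $X$ a finite two-dimensional simplicial complex with $[w]\subseteq F_0(X)$ which is $(\epsilon,w)$-admissible for some $\epsilon>0$. Then $$f_2(X)\le\frac{2\chi(X)-2w+L(X)}{2e_w(X)-1}.$$
   Context: $F_i$ is the set and $f_i$ the number of $i$-faces; $\chi$ is Euler characteristic; $L(X)=2f_1(X)-3f_2(X)$. $e_w(X)=\min\{(f_0(Z)-w)/f_2(Z)\}$, the minimum over subcomplexes $Z\subseteq X$ with $[w]\subseteq F_0(Z)$ and $f_2(Z)>0$. $X$ is $(\epsilon,w)$-admissible if $e_w(X)\ge\frac12+\epsilon$. -}

module Defs where

open import Data.Nat as ℕ using (ℕ; zero; suc)
open import Data.Integer as ℤ using (ℤ; +_)
open import Data.Rational as ℚ using (ℚ; 0ℚ; _÷_; ≢-nonZero)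
open import Data.Rational.Properties using (_≟_)
open import Data.Product using (_×_; _,_; Σ; ∃; ∃-syntax)
open import Data.List using (List; length)
open import Data.List.Membership.Propositional using (_∈_)
open import Data.List.Relation.Unary.All using (All)
open import Data.List.Relation.Unary.Unique.Propositional using (Unique)
open import Relation.Nullary using (yes; no)

-- A vertex is a natural number; an edge {a,b} is stored as (a , b) with
-- a < b; a triangle {a,b,c} is stored as (a , b , c) with a < b < c.
-- Each list of faces is duplicate-free, so f_i is its length.

Edge : Set
Edge = ℕ × ℕ

Tri : Set
Tri = ℕ × ℕ × ℕ

WellOrderedEdge : Edge → Set
WellOrderedEdge (a , b) = a ℕ.< b

WellOrderedTri : Tri → Set
WellOrderedTri (a , b , c) = a ℕ.< b × b ℕ.< c

record Complex : Set where
  field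
    F₀ : List ℕ
    F₁ : List Edge
    F₂ : List Tri
    uniq₀ : Unique F₀
    uniq₁ : Unique F₁
    uniq₂ : Unique F₂
    ord₁ : All WellOrderedEdge F₁
    ord₂ : All WellOrderedTri F₂
    edge-verts : All (λ { (a , b) → a ∈ F₀ × b ∈ F₀ }) F₁
    tri-edges  : All (λ { (a , b , c) → (a , b) ∈ F₁ × (a , c) ∈ F₁ × (b , c) ∈ F₁ }) F₂
open Complex public

f₀ f₁ f₂ : Complex → ℕ
f₀ X = length (F₀ X)
f₁ X = length (F₁ X)
f₂ X = length (F₂ X)

χ : Complex → ℤ
χ X = + f₀ X ℤ.- + f₁ X ℤ.+ + f₂ X

L : Complex → ℤ
L X = + (2 ℕ.* f₁ X) ℤ.- + (3 ℕ.* f₂ X)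

_⊆ᶜ_ : Complex → Complex → Set
Z ⊆ᶜ X = All (_∈ F₀ X) (F₀ Z) × All (_∈ F₁ X) (F₁ Z) × All (_∈ F₂ X) (F₂ Z)

[_]⊆F₀ : ℕ → Complex → Set
[ w ]⊆F₀ Z = ∀ i → 1 ℕ.≤ i → i ℕ.≤ w → i ∈ F₀ Z

-- division of an integer by a natural number (only used with d > 0)
_/ℕ_ : ℤ → ℕ → ℚ
n /ℕ zero  = 0ℚ
n /ℕ suc d = n ℚ./ suc d

-- total division on ℚ (only used with nonzero denominator)
_÷'_ : ℚ → ℚ → ℚ
p ÷' q with q ≟ 0ℚ
... | yes _  = 0ℚ
... | no q≢0 = _÷_ p q {{≢-nonZero q≢0}}

ratio : ℕ → Complex → ℚ
ratio w Z = (+ f₀ Z ℤ.- + w) /ℕ f₂ Z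

Admissible-Sub : ℕ → Complex → Complex → Set
Admissible-Sub w X Z = Z ⊆ᶜ X × [ w ]⊆F₀ Z × 0 ℕ.< f₂ Z

IsEw : ℕ → Complex → ℚ → Set
IsEw w X e =
  (∃[ Z ] (Admissible-Sub w X Z × ratio w Z ≡' e)) ×
  (∀ Z → Admissible-Sub w X Z → e ℚ.≤ ratio w Z)
  where
  open import Relation.Binary.PropositionalEquality renaming (_≡_ to _≡'_)

EpsAdmissible : ℚ → ℕ → Complex → Set
EpsAdmissible ε w X = ∃[ e ] (IsEw w X e × ℚ.½ ℚ.+ ε ℚ.≤ e)

module Submission where

-- The bound  f₂(X) ≤ (2χ(X) − 2w + L(X)) / (2e_w(X) − 1)  follows from
-- testing the minimum defining e_w(X) on X itself.
--
-- * X is one of the competitors in that minimum: it contains the subcomplex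
--   attaining e_w(X), hence has a triangle, and [w] ⊆ F₀(X) by hypothesis.
--   So  e ≤ (f₀ − w)/f₂,  i.e.  f₂·e ≤ f₀ − w.
-- * Since e_w(X) is unique, admissibility gives  e ≥ ½ + ε > ½.
-- * Counting,  2χ − 2w + L = 2(f₀ − w) − f₂,  so
--       f₂·(2e − 1) = 2·f₂·e − f₂ ≤ 2(f₀ − w) − f₂ = 2χ − 2w + L,
--   and dividing by the positive number 2e − 1 gives the claim.

open import Defs
open import Data.Nat as ℕ using (ℕ)
open import Data.Integer as ℤ using (+_)
open import Data.Rational as ℚ using (ℚ; 0ℚ; _/_)

open import Data.Nat using (suc; z≤n; s≤s)
open import Data.Integer using (ℤ)
import Data.Integer.Properties as ℤP
open import Data.Integer.Tactic.RingSolver using (solve-∀)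
open import Data.Rational using (½; 1ℚ; toℚᵘ; fromℚᵘ)
import Data.Rational.Properties as ℚP
open import Data.Rational.Solver using (module +-*-Solver)
import Data.Rational.Unnormalised as ℚᵘ
import Data.Rational.Unnormalised.Properties as ℚᵘP
open import Data.Product using (_,_; proj₂)
open import Data.List using (List; []; _∷_; length)
open import Data.List.Membership.Propositional using (_∈_)
open import Data.List.Relation.Unary.All as All using (All; _∷_)
open import Relation.Nullary using (yes; no; contradiction)
open import Relation.Binary.PropositionalEquality

module _ where
  open ℚᵘP.≃-Reasoning

  -- `toℚᵘ` is a homomorphism and a section of `fromℚᵘ` up to ≃, so
  -- `fromℚᵘ` preserves sums, products and negation.
  fromℚᵘ-homo-+ : ∀ p q → fromℚᵘ (p ℚᵘ.+ q) ≡ fromℚᵘ p ℚ.+ fromℚᵘ q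
  fromℚᵘ-homo-+ p q = ℚP.toℚᵘ-injective (begin
    toℚᵘ (fromℚᵘ (p ℚᵘ.+ q))                 ≈⟨ ℚP.toℚᵘ-fromℚᵘ (p ℚᵘ.+ q) ⟩
    p ℚᵘ.+ q                                 ≈⟨ ℚᵘP.+-cong (ℚᵘP.≃-sym (ℚP.toℚᵘ-fromℚᵘ p))
                                                           (ℚᵘP.≃-sym (ℚP.toℚᵘ-fromℚᵘ q)) ⟩
    toℚᵘ (fromℚᵘ p) ℚᵘ.+ toℚᵘ (fromℚᵘ q)     ≈⟨ ℚᵘP.≃-sym (ℚP.toℚᵘ-homo-+ (fromℚᵘ p) (fromℚᵘ q)) ⟩
    toℚᵘ (fromℚᵘ p ℚ.+ fromℚᵘ q)             ∎)

  fromℚᵘ-homo-* : ∀ p q → fromℚᵘ (p ℚᵘ.* q) ≡ fromℚᵘ p ℚ.* fromℚᵘ q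
  fromℚᵘ-homo-* p q = ℚP.toℚᵘ-injective (begin
    toℚᵘ (fromℚᵘ (p ℚᵘ.* q))                 ≈⟨ ℚP.toℚᵘ-fromℚᵘ (p ℚᵘ.* q) ⟩
    p ℚᵘ.* q                                 ≈⟨ ℚᵘP.*-cong (ℚᵘP.≃-sym (ℚP.toℚᵘ-fromℚᵘ p))
                                                           (ℚᵘP.≃-sym (ℚP.toℚᵘ-fromℚᵘ q)) ⟩
    toℚᵘ (fromℚᵘ p) ℚᵘ.* toℚᵘ (fromℚᵘ q)     ≈⟨ ℚᵘP.≃-sym (ℚP.toℚᵘ-homo-* (fromℚᵘ p) (fromℚᵘ q)) ⟩
    toℚᵘ (fromℚᵘ p ℚ.* fromℚᵘ q)             ∎)

  fromℚᵘ-homo‿- : ∀ p → fromℚᵘ (ℚᵘ.- p) ≡ ℚ.- fromℚᵘ p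
  fromℚᵘ-homo‿- p = ℚP.toℚᵘ-injective (begin
    toℚᵘ (fromℚᵘ (ℚᵘ.- p))                   ≈⟨ ℚP.toℚᵘ-fromℚᵘ (ℚᵘ.- p) ⟩
    ℚᵘ.- p                                   ≈⟨ ℚᵘP.-‿cong (ℚᵘP.≃-sym (ℚP.toℚᵘ-fromℚᵘ p)) ⟩
    ℚᵘ.- toℚᵘ (fromℚᵘ p)                     ≈⟨ ℚᵘP.≃-sym (ℚP.toℚᵘ-homo‿- (fromℚᵘ p)) ⟩
    toℚᵘ (ℚ.- fromℚᵘ p)                      ∎)

-- The embedding ι : ℤ → ℚ, in the form i / 1 used by the statement.
-- Note that  i / suc k  is by definition  fromℚᵘ (i ℚᵘ./ suc k).

ι : ℤ → ℚ
ι i = i / 1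

module _ where
  open ≡-Reasoning

  ι-homo-+ : ∀ a b → ι (a ℤ.+ b) ≡ ι a ℚ.+ ι b
  ι-homo-+ a b = begin
    fromℚᵘ ((a ℤ.+ b) ℚᵘ./ 1)             ≡⟨ ℚP.fromℚᵘ-cong {(a ℤ.+ b) ℚᵘ./ 1} {a+b}
                                                              (ℚᵘ.*≡* (cross a b)) ⟩
    fromℚᵘ a+b                            ≡⟨ fromℚᵘ-homo-+ (a ℚᵘ./ 1) (b ℚᵘ./ 1) ⟩
    ι a ℚ.+ ι b                           ∎
    where
    a+b = (a ℚᵘ./ 1) ℚᵘ.+ (b ℚᵘ./ 1)
    cross : ∀ a b → (a ℤ.+ b) ℤ.* + 1 ≡ (a ℤ.* + 1 ℤ.+ b ℤ.* + 1) ℤ.* + 1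
    cross = solve-∀

  ι-homo-* : ∀ a b → ι (a ℤ.* b) ≡ ι a ℚ.* ι b
  ι-homo-* a b = fromℚᵘ-homo-* (a ℚᵘ./ 1) (b ℚᵘ./ 1)

  ι-homo‿- : ∀ a → ι (ℤ.- a) ≡ ℚ.- ι a
  ι-homo‿- a = fromℚᵘ-homo‿- (a ℚᵘ./ 1)

  ι-*-/ : ∀ n a .{{_ : ℕ.NonZero n}} → ι (+ n) ℚ.* (a / n) ≡ ι a
  ι-*-/ n@(suc n-1) a = begin
    fromℚᵘ (+ n ℚᵘ./ 1) ℚ.* fromℚᵘ (a ℚᵘ./ n)   ≡⟨ fromℚᵘ-homo-* (+ n ℚᵘ./ 1) (a ℚᵘ./ n) ⟨
    fromℚᵘ n·a/n                                ≡⟨ ℚP.fromℚᵘ-cong {n·a/n} {a ℚᵘ./ 1}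
                                                                    (ℚᵘ.*≡* (cross (+ n) a)) ⟩
    fromℚᵘ (a ℚᵘ./ 1)                           ∎
    where
    n·a/n = (+ n ℚᵘ./ 1) ℚᵘ.* (a ℚᵘ./ n)
    cross : ∀ m a → (m ℤ.* a) ℤ.* + 1 ≡ a ℤ.* (+ 1 ℤ.* m)
    cross = solve-∀

*≤⇒≤÷' : ∀ p q r → 0ℚ ℚ.< r → p ℚ.* r ℚ.≤ q → p ℚ.≤ q ÷' r
*≤⇒≤÷' p q r 0<r pr≤q with r ℚP.≟ 0ℚ
... | yes r≡0 = contradiction (sym r≡0) (ℚP.<⇒≢ 0<r)
... | no  r≢0 = ℚP.*-cancelʳ-≤-pos r {{ℚ.positive 0<r}} (subst (p ℚ.* r ℚ.≤_) (sym q÷r·r≡q) pr≤q)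
  where
  instance
    r-nonZero : ℚ.NonZero r
    r-nonZero = ℚ.≢-nonZero r≢0
  open ≡-Reasoning
  q÷r·r≡q : (q ℚ.÷ r) ℚ.* r ≡ q
  q÷r·r≡q = begin
    (q ℚ.* ℚ.1/ r) ℚ.* r   ≡⟨ ℚP.*-assoc q (ℚ.1/ r) r ⟩
    q ℚ.* (ℚ.1/ r ℚ.* r)   ≡⟨ cong (q ℚ.*_) (ℚP.*-inverseˡ r) ⟩
    q ℚ.* 1ℚ               ≡⟨ ℚP.*-identityʳ q ⟩
    q                      ∎

-- The core estimate: for f ≥ 1 and ½ < e ≤ a/f,
--   f ≤ (2a − f) / (2e − 1).
-- Indeed f·e ≤ a, so f·(2e − 1) = 2·f·e − f ≤ 2a − f, and 2e − 1 > 0.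
core-bound : ∀ f a e .{{_ : ℕ.NonZero f}} → ½ ℚ.< e → e ℚ.≤ a / f →
             ι (+ f) ℚ.≤ ι (+ 2 ℤ.* a ℤ.- + f) ÷' (ι (+ 2) ℚ.* e ℚ.- ι (+ 1))
core-bound f a e ½<e e≤a/f = *≤⇒≤÷' F (ι (+ 2 ℤ.* a ℤ.- + f)) d 0<d Fd≤N
  where
  F = ι (+ f)
  d = ι (+ 2) ℚ.* e ℚ.- ι (+ 1)

  instance
    F-nonNeg : ℚ.NonNegative F
    F-nonNeg = ℚP.normalize-nonNeg f 1

  -- 2e − 1 > 2·½ − 1 = 0
  0<d : 0ℚ ℚ.< d
  0<d = ℚP.+-monoˡ-< (ℚ.- ι (+ 1)) (ℚP.*-monoʳ-<-pos (ι (+ 2)) ½<e)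

  Fe≤a : F ℚ.* e ℚ.≤ ι a
  Fe≤a = subst (F ℚ.* e ℚ.≤_) (ι-*-/ f a) (ℚP.*-monoˡ-≤-nonNeg F e≤a/f)

  open +-*-Solver using (solve; _:=_; _:*_; _:-_; con)
  expand : ∀ F c e → F ℚ.* (c ℚ.* e ℚ.- 1ℚ) ≡ c ℚ.* (F ℚ.* e) ℚ.- F
  expand = solve 3 (λ F c e → F :* (c :* e :- con 1ℚ) := c :* (F :* e) :- F) refl

  Fd≤N : F ℚ.* d ℚ.≤ ι (+ 2 ℤ.* a ℤ.- + f)
  Fd≤N = begin
    F ℚ.* d                          ≡⟨ expand F (ι (+ 2)) e ⟩
    ι (+ 2) ℚ.* (F ℚ.* e) ℚ.- F      ≤⟨ ℚP.+-monoˡ-≤ (ℚ.- F) (ℚP.*-monoˡ-≤-nonNeg (ι (+ 2)) Fe≤a) ⟩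
    ι (+ 2) ℚ.* ι a ℚ.- F            ≡⟨ cong₂ ℚ._-_ (ι-homo-* (+ 2) a) refl ⟨
    ι (+ 2 ℤ.* a) ℚ.- F              ≡⟨ cong (ι (+ 2 ℤ.* a) ℚ.+_) (ι-homo‿- (+ f)) ⟨
    ι (+ 2 ℤ.* a) ℚ.+ ι (ℤ.- + f)    ≡⟨ ι-homo-+ (+ 2 ℤ.* a) (ℤ.- + f) ⟨
    ι (+ 2 ℤ.* a ℤ.- + f)            ∎
    where open ℚP.≤-Reasoning

/ℕ≡/ : ∀ a n .{{_ : ℕ.NonZero n}} → a /ℕ n ≡ a / n
/ℕ≡/ a (suc _) = refl

nonempty-⊆ : ∀ {A : Set} {xs ys : List A} → All (_∈ ys) xs → 0 ℕ.< length xs → 0 ℕ.< length ys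
nonempty-⊆ {ys = []}    (() ∷ _) _
nonempty-⊆ {ys = _ ∷ _} _        _ = s≤s z≤n

⊆ᶜ-refl : ∀ X → X ⊆ᶜ X
⊆ᶜ-refl X = All.tabulate (λ x∈ → x∈) , All.tabulate (λ x∈ → x∈) , All.tabulate (λ x∈ → x∈)

-- As soon as the minimum defining e_w(X) ranges over some subcomplex Z, it
-- also ranges over X itself: X contains Z's triangles, and [w] ⊆ F₀(X).
self-admissible : ∀ w X Z → [ w ]⊆F₀ X → Admissible-Sub w X Z → Admissible-Sub w X X
self-admissible w X Z [w]⊆X ((_ , _ , F₂Z⊆F₂X) , _ , 0<f₂Z) =
  ⊆ᶜ-refl X , [w]⊆X , nonempty-⊆ F₂Z⊆F₂X 0<f₂Z

IsEw-unique : ∀ w X {e e′} → IsEw w X e → IsEw w X e′ → e ≡ e′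
IsEw-unique w X ((Z , Z-adm , rZ≡e) , e-min) ((Z′ , Z′-adm , rZ′≡e′) , e′-min) =
  ℚP.≤-antisym (subst (_ ℚ.≤_) rZ′≡e′ (e-min Z′ Z′-adm))
               (subst (_ ℚ.≤_) rZ≡e (e′-min Z Z-adm))

counting : ∀ w X → + 2 ℤ.* χ X ℤ.- + (2 ℕ.* w) ℤ.+ L X ≡ + 2 ℤ.* (+ f₀ X ℤ.- + w) ℤ.- + f₂ X
counting w X rewrite ℤP.pos-* 2 w | ℤP.pos-* 2 (f₁ X) | ℤP.pos-* 3 (f₂ X) =
  identity (+ f₀ X) (+ f₁ X) (+ f₂ X) (+ w)
  where
  identity : ∀ a b c d → + 2 ℤ.* (a ℤ.- b ℤ.+ c) ℤ.- + 2 ℤ.* d ℤ.+ (+ 2 ℤ.* b ℤ.- + 3 ℤ.* c)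
                         ≡ + 2 ℤ.* (a ℤ.- d) ℤ.- c
  identity = solve-∀

lemma5p1 : (w : ℕ) (X : Complex) → [ w ]⊆F₀ X →
           (ε : ℚ) → 0ℚ ℚ.< ε → EpsAdmissible ε w X →
           (e : ℚ) → IsEw w X e →
           (+ f₂ X / 1) ℚ.≤ ((+ 2 ℤ.* χ X ℤ.- + (2 ℕ.* w) ℤ.+ L X) / 1)
                            ÷' ((+ 2 / 1) ℚ.* e ℚ.- (+ 1 / 1))
lemma5p1 w X [w]⊆X ε 0<ε (e′ , isEw′ , ½+ε≤e′) e isEw@((Z , Z-adm , _) , e-min) =
  subst (λ N → ι (+ f₂ X) ℚ.≤ ι N ÷' (ι (+ 2) ℚ.* e ℚ.- ι (+ 1))) (sym (counting w X))
        (core-bound (f₂ X) (+ f₀ X ℤ.- + w) e ½<e e≤ratio)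
  where
  X-adm : Admissible-Sub w X X
  X-adm = self-admissible w X Z [w]⊆X Z-adm

  instance
    f₂-nonZero : ℕ.NonZero (f₂ X)
    f₂-nonZero = ℕ.>-nonZero (proj₂ (proj₂ X-adm))

  -- X itself is a competitor in the minimum e_w(X).
  e≤ratio : e ℚ.≤ (+ f₀ X ℤ.- + w) / f₂ X
  e≤ratio = subst (e ℚ.≤_) (/ℕ≡/ (+ f₀ X ℤ.- + w) (f₂ X)) (e-min X X-adm)

  -- Admissibility: e = e′ ≥ ½ + ε > ½.
  ½<e : ½ ℚ.< e
  ½<e = ℚP.<-≤-trans ½<½+ε (subst (½ ℚ.+ ε ℚ.≤_) (IsEw-unique w X isEw′ isEw) ½+ε≤e′)
    where
    ½<½+ε : ½ ℚ.< ½ ℚ.+ ε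
    ½<½+ε = subst (ℚ._< ½ ℚ.+ ε) (ℚP.+-identityʳ ½) (ℚP.+-monoʳ-< ½ 0<ε)
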